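{- Let $n\ge 2$ and let $G=P_n$ be the path on $n$ vertices. Then $$\zeta(G)=\begin{cases}1, & \text{if } n\equiv 0 \pmod 3,\\ \dfrac{(n+2)(n+11)}{18}-1, & \text{if } n\equiv 1\pmod 3,\\ \left\lceil \dfrac{n}{3}\right\rceil+1, & \text{if } n\equiv 2\pmod 3.\end{cases}$$
   Context: All graphs are finite and simple. For a graph $G=(V,E)$, a set $S\subseteq V$ is a dominating set if every vertex of $V\setminus S$ is adjacent to some vertex of $S$. The domination number $\gamma(G)$ is the minimum cardinality of a dominating set; a dominating set of cardinality $\gamma(G)$ is called a $\gamma$-set. The dominion $\zeta(G)$ is the number of $\gamma$-sets of $G$. -}

module Defs where

open import Data.Nat using (ℕ; zero; suc; _+_; _⊓_)
open import Data.Fin using (Fin; toℕ)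
open import Data.Fin.Subset using (Subset; _∈_; ∣_∣)
open import Data.Fin.Subset.Properties using (_∈?_)
open import Data.Fin.Properties using (all?; any?)
open import Data.Vec using ([]; _∷_)
open import Data.Bool using (true; false)
open import Data.List using (List; []; _∷_; map; _++_; filter; length; foldr)
open import Data.Product using (Σ; _×_; _,_)
open import Data.Sum using (_⊎_)
open import Data.Empty using (⊥)
open import Relation.Nullary using (Dec; _×-dec_; _⊎-dec_)
open import Relation.Binary.PropositionalEquality using (_≡_)
import Data.Nat.Properties as ℕP
open import Relation.Nullary.Decidable using (⌊_⌋)

record Graph (n : ℕ) : Set₁ where
  field
    Adj   : Fin n → Fin n → Set
    Adj?  : (u v : Fin n) → Dec (Adj u v)
    sym   : ∀ {u v} → Adj u v → Adj v u
    irrefl : ∀ {u} → Adj u u → ⊥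
open Graph public

Dominating : ∀ {n} → Graph n → Subset n → Set
Dominating {n} G S = (v : Fin n) → v ∈ S ⊎ Σ (Fin n) (λ u → u ∈ S × Adj G u v)

dominating? : ∀ {n} (G : Graph n) (S : Subset n) → Dec (Dominating G S)
dominating? G S = all? (λ v → (v ∈? S) ⊎-dec any? (λ u → (u ∈? S) ×-dec Adj? G u v))

allSubsets : (n : ℕ) → List (Subset n)
allSubsets zero = [] ∷ []
allSubsets (suc n) = map (true ∷_) (allSubsets n) ++ map (false ∷_) (allSubsets n)

dominatingSets : ∀ {n} → Graph n → List (Subset n)
dominatingSets {n} G = filter (dominating? G) (allSubsets n)

-- Domination number: minimum cardinality of a dominating set
-- (n is an upper bound, as the full vertex set dominates).
γ : ∀ {n} → Graph n → ℕ
γ {n} G = foldr (λ S m → ∣ S ∣ ⊓ m) n (dominatingSets G)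

ζ : ∀ {n} → Graph n → ℕ
ζ G = length (filter (λ S → ∣ S ∣ ℕP.≟ γ G) (dominatingSets G))

PathAdj : ∀ {n} → Fin n → Fin n → Set
PathAdj i j = suc (toℕ i) ≡ toℕ j ⊎ suc (toℕ j) ≡ toℕ i

P : (n : ℕ) → Graph n
P n = record
  { Adj = PathAdj
  ; Adj? = λ i j → (suc (toℕ i) ℕP.≟ toℕ j) ⊎-dec (suc (toℕ j) ℕP.≟ toℕ i)
  ; sym = λ { (Data.Sum.inj₁ e) → Data.Sum.inj₂ e ; (Data.Sum.inj₂ e) → Data.Sum.inj₁ e }
  ; irrefl = λ { {u} (Data.Sum.inj₁ e) → ℕP.1+n≢n e
               ; {u} (Data.Sum.inj₂ e) → ℕP.1+n≢n e }
  }

{-# OPTIONS --safe #-}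
module Submission where

-- Read a set S of vertices of the path from left to right with a three-state automaton that
-- remembers whether the last vertex is in S, is dominated by its left neighbour, or still needs
-- its right neighbour; S dominates the path iff the automaton, started as if a dominated vertex
-- preceded the path, ends in one of the first two states. Counting accepted sets by size gives
-- for each state s a polynomial p_s(m) in x, and reading one more vertex gives
-- p_s(m+1) = x·p_chosen(m) + p_s'(m), with s' the state after reading a non-member (p_s' = 0 if
-- there is none). The domination number and the dominion are the degree and the coefficient of
-- the lowest term of p_covered(m), and these lowest terms are followed through the recurrence
-- along m = 3q, 3q+1, 3q+2.

open import Defs
open import Data.Bool using (Bool; true; false; _∧_; _∨_; T; T?)
open import Data.Bool.Properties using (T-∧; T-∨)
open import Data.Empty using (⊥-elim)
open import Data.Fin using (Fin; zero; suc; toℕ)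
open import Data.Fin.Properties using (toℕ-injective)
open import Data.Fin.Subset using (Subset; _∈_; ∣_∣)
open import Data.List using (List; []; _∷_; map; _++_; filter; filterᵇ; length; foldr)
open import Data.List.Properties using (filter-++; filter-≐; filter-none; length-++)
open import Data.List.Relation.Unary.All using (universal)
open import Data.Nat using (ℕ; zero; suc; _+_; _*_; _∸_; _/_; _%_; _≤_; _<_; _⊓_; _≟_; _≡ᵇ_; s≤s)
open import Data.Nat.DivMod using (m≡m%n+[m/n]*n; m*n/n≡m; /-congˡ; +-distrib-/-∣ʳ)
open import Data.Nat.Divisibility using (divides-refl)
open import Data.Nat.Properties
  using ( ≤-antisym; ≤-trans; ≤-reflexive; ≤-refl; ⊓-glb; m⊓n≤m; m⊓n≤n; ≮⇒≥; m≤m*n; m≤n⇒m≤1+n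
        ; +-comm; *-assoc; +-identityʳ; 0≢1+n )
open import Data.Nat.Tactic.RingSolver using (solve-∀)
open import Data.Product using (Σ; ∃-syntax; _×_; _,_; proj₁; proj₂)
open import Data.Sum using (_⊎_; inj₁; inj₂; map₂)
open import Data.Unit using (tt)
open import Data.Vec using ([]; _∷_; here; there)
open import Function using (_∘_)
open import Function.Bundles using (_⇔_; mk⇔; Equivalence)
open import Relation.Nullary using (¬_; yes; no; does)
open import Relation.Unary using (Decidable)
open import Relation.Binary.PropositionalEquality as ≡
  using (_≡_; _≢_; refl; trans; cong; cong₂; subst; _≗_; module ≡-Reasoning)

open Equivalence using (to; from)

private
  variable
    n f g h : ℕ
    F G : ℕ → ℕ
    l : Bool

-- A function F : ℕ → ℕ stands for the power series Σ F k xᵏ, so shift is multiplication by x.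
shift : (ℕ → ℕ) → ℕ → ℕ
shift F zero    = 0
shift F (suc k) = F k

record LowestTerm (F : ℕ → ℕ) (f g : ℕ) : Set where
  field
    vanishes-below : ∀ {k} → k < f → F k ≡ 0
    coefficient    : F f ≡ g
open LowestTerm

LowestTerm-≗ : F ≗ G → LowestTerm G f g → LowestTerm F f g
LowestTerm-≗ F≗G L = record
  { vanishes-below = λ k<f → trans (F≗G _) (vanishes-below L k<f)
  ; coefficient    = trans (F≗G _) (coefficient L)
  }

LowestTerm-shift : LowestTerm F f g → LowestTerm (shift F) (suc f) g
LowestTerm-shift L = record
  { vanishes-below = λ { {zero} _ → refl ; {suc k} (s≤s k<f) → vanishes-below L k<f }
  ; coefficient    = coefficient L
  }

LowestTerm-+ : LowestTerm F f g → LowestTerm G f h → LowestTerm (λ k → F k + G k) f (g + h)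
LowestTerm-+ L M = record
  { vanishes-below = λ k<f → cong₂ _+_ (vanishes-below L k<f) (vanishes-below M k<f)
  ; coefficient    = cong₂ _+_ (coefficient L) (coefficient M)
  }

LowestTerm-shift+ : LowestTerm F f g → LowestTerm G f h → LowestTerm (λ k → shift F k + G k) f h
LowestTerm-shift+ L M = record
  { vanishes-below = λ k<f → cong₂ _+_ (vanishes-below shifted (m≤n⇒m≤1+n k<f)) (vanishes-below M k<f)
  ; coefficient    = cong₂ _+_ (vanishes-below shifted ≤-refl) (coefficient M)
  }
  where shifted = LowestTerm-shift L

hasSize? : ∀ k → Decidable (λ (S : Subset n) → ∣ S ∣ ≡ k)
hasSize? k S = ∣ S ∣ ≟ k

sizeProfile : List (Subset n) → ℕ → ℕ
sizeProfile Ss k = length (filter (hasSize? k) Ss)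

sizeProfile-++ : ∀ (Ss Ts : List (Subset n)) k →
                 sizeProfile (Ss ++ Ts) k ≡ sizeProfile Ss k + sizeProfile Ts k
sizeProfile-++ Ss Ts k =
  trans (cong length (filter-++ (hasSize? k) Ss Ts)) (length-++ (filter (hasSize? k) Ss))

sizeProfile-map-true : ∀ (Ss : List (Subset n)) → sizeProfile (map (true ∷_) Ss) ≗ shift (sizeProfile Ss)
sizeProfile-map-true []       zero    = refl
sizeProfile-map-true []       (suc k) = refl
sizeProfile-map-true (S ∷ Ss) zero    = sizeProfile-map-true Ss zero
sizeProfile-map-true (S ∷ Ss) (suc k) with ∣ S ∣ ≡ᵇ k
... | true  = cong suc (sizeProfile-map-true Ss (suc k))
... | false = sizeProfile-map-true Ss (suc k)

sizeProfile-map-false : ∀ (Ss : List (Subset n)) → sizeProfile (map (false ∷_) Ss) ≗ sizeProfile Ss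
sizeProfile-map-false []       k = refl
sizeProfile-map-false (S ∷ Ss) k with ∣ S ∣ ≡ᵇ k
... | true  = cong suc (sizeProfile-map-false Ss k)
... | false = sizeProfile-map-false Ss k

length-filter-∷≡0 : ∀ {A : Set} {P : A → Set} (P? : Decidable P) x xs →
                    length (filter P? (x ∷ xs)) ≡ 0 → ¬ P x × length (filter P? xs) ≡ 0
length-filter-∷≡0 P? x xs eq with P? x
length-filter-∷≡0 P? x xs () | yes _
... | no ¬px = ¬px , eq

length-filter-∷≢0 : ∀ {A : Set} {P : A → Set} (P? : Decidable P) x xs →
                    length (filter P? (x ∷ xs)) ≢ 0 → P x ⊎ length (filter P? xs) ≢ 0
length-filter-∷≢0 P? x xs ne with P? x
... | yes px = inj₁ px
... | no  _  = inj₂ ne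

foldr-⊓-≥ : ∀ (Ss : List (Subset n)) {b} → f ≤ b → (∀ {k} → k < f → sizeProfile Ss k ≡ 0) →
            f ≤ foldr (λ S m → ∣ S ∣ ⊓ m) b Ss
foldr-⊓-≥ []       f≤b _     = f≤b
foldr-⊓-≥ (S ∷ Ss) f≤b empty =
  ⊓-glb (≮⇒≥ (λ ∣S∣<f → proj₁ (length-filter-∷≡0 (hasSize? ∣ S ∣) S Ss (empty ∣S∣<f)) refl))
        (foldr-⊓-≥ Ss f≤b (λ {k} k<f → proj₂ (length-filter-∷≡0 (hasSize? k) S Ss (empty k<f))))

foldr-⊓-≤ : ∀ (Ss : List (Subset n)) b → sizeProfile Ss f ≢ 0 → foldr (λ S m → ∣ S ∣ ⊓ m) b Ss ≤ f
foldr-⊓-≤ []           b nonempty = ⊥-elim (nonempty refl)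
foldr-⊓-≤ {f = f} (S ∷ Ss) b nonempty with length-filter-∷≢0 (hasSize? f) S Ss nonempty
... | inj₁ ∣S∣≡f    = ≤-trans (m⊓n≤m ∣ S ∣ _) (≤-reflexive ∣S∣≡f)
... | inj₂ nonempty′ = ≤-trans (m⊓n≤n ∣ S ∣ _) (foldr-⊓-≤ Ss b nonempty′)

γ-lowestTerm : (G : Graph n) → LowestTerm (sizeProfile (dominatingSets G)) f (suc g) → f ≤ n → γ G ≡ f
γ-lowestTerm {n} G L f≤n =
  ≤-antisym (foldr-⊓-≤ (dominatingSets G) n (λ eq → 0≢1+n (trans (≡.sym eq) (coefficient L))))
            (foldr-⊓-≥ (dominatingSets G) f≤n (vanishes-below L))

ζ-lowestTerm : (G : Graph n) → LowestTerm (sizeProfile (dominatingSets G)) f (suc g) → f ≤ n →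
               ζ G ≡ suc g
ζ-lowestTerm G L f≤n =
  trans (cong (sizeProfile (dominatingSets G)) (γ-lowestTerm G L f≤n)) (coefficient L)

-- Indices outside Fin n are not members.
_∈ᵇ_ : ℕ → Subset n → Bool
i     ∈ᵇ []      = false
zero  ∈ᵇ (x ∷ S) = x
suc i ∈ᵇ (x ∷ S) = i ∈ᵇ S

∈⇒∈ᵇ : ∀ {u : Fin n} {S} → u ∈ S → T (toℕ u ∈ᵇ S)
∈⇒∈ᵇ here      = tt
∈⇒∈ᵇ (there p) = ∈⇒∈ᵇ p

∈ᵇ⇒∈ : ∀ {S : Subset n} i → T (i ∈ᵇ S) → ∃[ u ] toℕ u ≡ i × u ∈ S
∈ᵇ⇒∈ {S = true ∷ S} zero    _ = zero , refl , here
∈ᵇ⇒∈ {S = x ∷ S}    (suc i) t = let u , toℕu≡i , u∈S = ∈ᵇ⇒∈ i t in suc u , cong suc toℕu≡i , there u∈S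

-- Looking up toℕ v in l ∷ S asks for the left neighbour of v, where l stands for
-- membership of a vertex attached to the left of vertex 0.
DominatedAt : Bool → Subset n → Fin n → Set
DominatedAt l S v = T (toℕ v ∈ᵇ (l ∷ S)) ⊎ T (toℕ v ∈ᵇ S) ⊎ T (suc (toℕ v) ∈ᵇ S)

path-dominated⇔ : ∀ {S : Subset n} {v} →
                  (v ∈ S ⊎ Σ (Fin n) λ u → u ∈ S × PathAdj u v) ⇔ DominatedAt false S v
path-dominated⇔ {n} {S} {v} = mk⇔ ⇒ ⇐
  where
  ⇒ : v ∈ S ⊎ Σ (Fin n) (λ u → u ∈ S × PathAdj u v) → DominatedAt false S v
  ⇒ (inj₁ v∈S)                    = inj₂ (inj₁ (∈⇒∈ᵇ v∈S))
  ⇒ (inj₂ (u , u∈S , inj₁ 1+u≡v)) = inj₁ (subst (λ i → T (i ∈ᵇ (false ∷ S))) 1+u≡v (∈⇒∈ᵇ u∈S))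
  ⇒ (inj₂ (u , u∈S , inj₂ 1+v≡u)) = inj₂ (inj₂ (subst (λ i → T (i ∈ᵇ S)) (≡.sym 1+v≡u) (∈⇒∈ᵇ u∈S)))

  ⇐ : DominatedAt false S v → v ∈ S ⊎ Σ (Fin n) (λ u → u ∈ S × PathAdj u v)
  ⇐ (inj₁ t) with ∈ᵇ⇒∈ {S = false ∷ S} (toℕ v) t
  ... | suc u , 1+u≡v , there u∈S = inj₂ (u , u∈S , inj₁ 1+u≡v)
  ⇐ (inj₂ (inj₁ t)) with ∈ᵇ⇒∈ (toℕ v) t
  ... | u , u≡v , u∈S = inj₁ (subst (_∈ S) (toℕ-injective u≡v) u∈S)
  ⇐ (inj₂ (inj₂ t)) with ∈ᵇ⇒∈ (suc (toℕ v)) t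
  ... | u , u≡1+v , u∈S = inj₂ (u , u∈S , inj₂ (≡.sym u≡1+v))

dominatesᵇ : Bool → Subset n → Bool
dominatesᵇ l []      = true
dominatesᵇ l (x ∷ S) = (l ∨ x ∨ 0 ∈ᵇ S) ∧ dominatesᵇ x S

T-∨³ : ∀ {a b c} → T (a ∨ b ∨ c) ⇔ (T a ⊎ T b ⊎ T c)
T-∨³ = mk⇔ (map₂ (to T-∨) ∘ to T-∨) (from T-∨ ∘ map₂ (from T-∨))

dominatesᵇ⇔ : ∀ {S : Subset n} → T (dominatesᵇ l S) ⇔ (∀ v → DominatedAt l S v)
dominatesᵇ⇔ {S = []}            = mk⇔ (λ _ ()) (λ _ → tt)
dominatesᵇ⇔ {l = l} {S = x ∷ S} = mk⇔ ⇒ ⇐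
  where
  ⇒ : T (dominatesᵇ l (x ∷ S)) → ∀ v → DominatedAt l (x ∷ S) v
  ⇒ t zero    = to T-∨³ (proj₁ (to T-∧ t))
  ⇒ t (suc v) = to dominatesᵇ⇔ (proj₂ (to T-∧ t)) v

  ⇐ : (∀ v → DominatedAt l (x ∷ S) v) → T (dominatesᵇ l (x ∷ S))
  ⇐ d = from T-∧ (from T-∨³ (d zero) , from dominatesᵇ⇔ (d ∘ suc))

data State : Set where
  chosen covered uncovered : State

-- The first clause leaves the state unmatched, so that accepts s (true ∷ S) reduces for every s.
accepts : State → Subset n → Bool
accepts s         (true ∷ S)  = accepts chosen S
accepts chosen    (false ∷ S) = accepts covered S
accepts covered   (false ∷ S) = accepts uncovered S
accepts uncovered (false ∷ S) = false
accepts uncovered []          = false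
accepts _         []          = true

accepts-chosen    : ∀ (S : Subset n) → accepts chosen S ≡ dominatesᵇ true S
accepts-covered   : ∀ (S : Subset n) → accepts covered S ≡ dominatesᵇ false S
accepts-uncovered : ∀ (S : Subset n) → accepts uncovered S ≡ 0 ∈ᵇ S ∧ dominatesᵇ false S

accepts-chosen []          = refl
accepts-chosen (true ∷ S)  = accepts-chosen S
accepts-chosen (false ∷ S) = accepts-covered S

accepts-covered []          = refl
accepts-covered (true ∷ S)  = accepts-chosen S
accepts-covered (false ∷ S) = accepts-uncovered S

accepts-uncovered []          = refl
accepts-uncovered (true ∷ S)  = accepts-chosen S
accepts-uncovered (false ∷ S) = refl

Dominating-P⇔accepts : ∀ {S : Subset n} → Dominating (P n) S ⇔ T (accepts covered S)
Dominating-P⇔accepts {S = S} = mk⇔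
  (λ d → subst T (≡.sym (accepts-covered S)) (from dominatesᵇ⇔ (λ v → to path-dominated⇔ (d v))))
  (λ t v → from path-dominated⇔ (to dominatesᵇ⇔ (subst T (accepts-covered S) t) v))

acceptedSets : State → (n : ℕ) → List (Subset n)
acceptedSets s n = filterᵇ (accepts s) (allSubsets n)

dominatingSets-P : dominatingSets (P n) ≡ acceptedSets covered n
dominatingSets-P {n} =
  filter-≐ (dominating? (P n)) (T? ∘ accepts covered)
           (to Dominating-P⇔accepts , from Dominating-P⇔accepts) (allSubsets n)

filter-map : ∀ {A B : Set} {P : B → Set} (P? : Decidable P) (f : A → B) xs →
             filter P? (map f xs) ≡ map f (filter (P? ∘ f) xs)
filter-map P? f []       = refl
filter-map P? f (x ∷ xs) with does (P? (f x))
... | true  = cong (f x ∷_) (filter-map P? f xs)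
... | false = filter-map P? f xs

acceptedSets-suc : ∀ s n → acceptedSets s (suc n) ≡
                   map (true ∷_) (acceptedSets chosen n)
                   ++ map (false ∷_) (filterᵇ (accepts s ∘ (false ∷_)) (allSubsets n))
acceptedSets-suc s n =
  trans (filter-++ (T? ∘ accepts s) (map (true ∷_) (allSubsets n)) (map (false ∷_) (allSubsets n)))
        (cong₂ _++_ (filter-map (T? ∘ accepts s) (true ∷_) (allSubsets n))
                    (filter-map (T? ∘ accepts s) (false ∷_) (allSubsets n)))

acceptedProfile : State → ℕ → ℕ → ℕ
acceptedProfile s n = sizeProfile (acceptedSets s n)

acceptedProfile-suc : ∀ s n → acceptedProfile s (suc n) ≗ λ k →
                      shift (acceptedProfile chosen n) k
                      + sizeProfile (filterᵇ (accepts s ∘ (false ∷_)) (allSubsets n)) k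
acceptedProfile-suc s n k = begin
  acceptedProfile s (suc n) k
    ≡⟨ cong (λ Ss → sizeProfile Ss k) (acceptedSets-suc s n) ⟩
  sizeProfile (map (true ∷_) (acceptedSets chosen n) ++ map (false ∷_) rest) k
    ≡⟨ sizeProfile-++ (map (true ∷_) (acceptedSets chosen n)) (map (false ∷_) rest) k ⟩
  sizeProfile (map (true ∷_) (acceptedSets chosen n)) k + sizeProfile (map (false ∷_) rest) k
    ≡⟨ cong₂ _+_ (sizeProfile-map-true (acceptedSets chosen n) k) (sizeProfile-map-false rest k) ⟩
  shift (acceptedProfile chosen n) k + sizeProfile rest k ∎
  where
  open ≡-Reasoning
  rest = filterᵇ (accepts s ∘ (false ∷_)) (allSubsets n)

acceptedProfile-chosen-suc : ∀ n → acceptedProfile chosen (suc n) ≗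
                             λ k → shift (acceptedProfile chosen n) k + acceptedProfile covered n k
acceptedProfile-chosen-suc = acceptedProfile-suc chosen

acceptedProfile-covered-suc : ∀ n → acceptedProfile covered (suc n) ≗
                              λ k → shift (acceptedProfile chosen n) k + acceptedProfile uncovered n k
acceptedProfile-covered-suc = acceptedProfile-suc covered

acceptedProfile-uncovered-suc : ∀ n →
                                acceptedProfile uncovered (suc n) ≗ shift (acceptedProfile chosen n)
acceptedProfile-uncovered-suc n k = begin
  acceptedProfile uncovered (suc n) k
    ≡⟨ acceptedProfile-suc uncovered n k ⟩
  shift (acceptedProfile chosen n) k + sizeProfile (filterᵇ (λ _ → false) (allSubsets n)) k
    ≡⟨ cong (λ Ss → shift (acceptedProfile chosen n) k + sizeProfile Ss k)
            (filter-none (T? ∘ λ _ → false) (universal (λ _ ()) (allSubsets n))) ⟩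
  shift (acceptedProfile chosen n) k + 0
    ≡⟨ +-identityʳ _ ⟩
  shift (acceptedProfile chosen n) k ∎
  where open ≡-Reasoning

ζ-P-lowestTerm : LowestTerm (acceptedProfile covered n) f (suc g) → f ≤ n → ζ (P n) ≡ suc g
ζ-P-lowestTerm {n} {f} {g} L =
  ζ-lowestTerm (P n)
    (subst (λ Ss → LowestTerm (sizeProfile Ss) f (suc g)) (≡.sym (dominatingSets-P {n})) L)

τ : ℕ → ℕ
τ zero    = 0
τ (suc q) = suc (suc (q + τ q))

LowestTerms : ℕ → (State → ℕ × ℕ) → Set
LowestTerms n t = ∀ s → LowestTerm (acceptedProfile s n) (proj₁ (t s)) (proj₂ (t s))

lowestTerms-3q   : ∀ q → LowestTerms (q * 3) λ
  { chosen → q , suc q ; covered → q , 1 ; uncovered → suc q , τ q }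
lowestTerms-3q+1 : ∀ q → LowestTerms (1 + q * 3) λ
  { chosen → q , 1 ; covered → suc q , suc q + τ q ; uncovered → suc q , suc q }
lowestTerms-3q+2 : ∀ q → LowestTerms (2 + q * 3) λ
  { chosen → suc q , τ (suc q) ; covered → suc q , suc (suc q) ; uncovered → suc q , 1 }

lowestTerms-3q zero chosen    = record { vanishes-below = λ () ; coefficient = refl }
lowestTerms-3q zero covered   = record { vanishes-below = λ () ; coefficient = refl }
lowestTerms-3q zero uncovered = record
  { vanishes-below = λ { {zero} _ → refl ; {suc _} (s≤s ()) }
  ; coefficient    = refl
  }
lowestTerms-3q (suc q) chosen =
  LowestTerm-≗ (acceptedProfile-chosen-suc (2 + q * 3))
    (LowestTerm-shift+ (lowestTerms-3q+2 q chosen) (lowestTerms-3q+2 q covered))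
lowestTerms-3q (suc q) covered =
  LowestTerm-≗ (acceptedProfile-covered-suc (2 + q * 3))
    (LowestTerm-shift+ (lowestTerms-3q+2 q chosen) (lowestTerms-3q+2 q uncovered))
lowestTerms-3q (suc q) uncovered =
  LowestTerm-≗ (acceptedProfile-uncovered-suc (2 + q * 3))
    (LowestTerm-shift (lowestTerms-3q+2 q chosen))

lowestTerms-3q+1 q chosen =
  LowestTerm-≗ (acceptedProfile-chosen-suc (q * 3))
    (LowestTerm-shift+ (lowestTerms-3q q chosen) (lowestTerms-3q q covered))
lowestTerms-3q+1 q covered =
  LowestTerm-≗ (acceptedProfile-covered-suc (q * 3))
    (LowestTerm-+ (LowestTerm-shift (lowestTerms-3q q chosen)) (lowestTerms-3q q uncovered))
lowestTerms-3q+1 q uncovered =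
  LowestTerm-≗ (acceptedProfile-uncovered-suc (q * 3))
    (LowestTerm-shift (lowestTerms-3q q chosen))

lowestTerms-3q+2 q chosen =
  LowestTerm-≗ (acceptedProfile-chosen-suc (1 + q * 3))
    (LowestTerm-+ (LowestTerm-shift (lowestTerms-3q+1 q chosen)) (lowestTerms-3q+1 q covered))
lowestTerms-3q+2 q covered =
  LowestTerm-≗ (acceptedProfile-covered-suc (1 + q * 3))
    (LowestTerm-+ (LowestTerm-shift (lowestTerms-3q+1 q chosen)) (lowestTerms-3q+1 q uncovered))
lowestTerms-3q+2 q uncovered =
  LowestTerm-≗ (acceptedProfile-uncovered-suc (1 + q * 3))
    (LowestTerm-shift (lowestTerms-3q+1 q chosen))

τ*2≡q*[q+3] : ∀ q → τ q * 2 ≡ q * (q + 3)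
τ*2≡q*[q+3] zero    = refl
τ*2≡q*[q+3] (suc q) = begin
  τ (suc q) * 2             ≡⟨ unfold q (τ q) ⟩
  4 + q * 2 + τ q * 2       ≡⟨ cong (4 + q * 2 +_) (τ*2≡q*[q+3] q) ⟩
  4 + q * 2 + q * (q + 3)   ≡⟨ expand q ⟩
  suc q * (suc q + 3)       ∎
  where
  open ≡-Reasoning
  unfold : ∀ q t → suc (suc (q + t)) * 2 ≡ 4 + q * 2 + t * 2
  unfold = solve-∀
  expand : ∀ q → 4 + q * 2 + q * (q + 3) ≡ suc q * (suc q + 3)
  expand = solve-∀

[1+p*3]/3≡p : ∀ p → (1 + p * 3) / 3 ≡ p
[1+p*3]/3≡p p = trans (+-distrib-/-∣ʳ 1 {d = 3} (divides-refl p)) (m*n/n≡m p 3)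

formula-1mod3 : ∀ q → ((1 + q * 3 + 2) * (1 + q * 3 + 11)) / 18 ∸ 1 ≡ suc q + τ q
formula-1mod3 q = cong (_∸ 1) (begin
  ((1 + q * 3 + 2) * (1 + q * 3 + 11)) / 18
    ≡⟨ /-congˡ {o = 18} (factor q) ⟩
  suc q * (suc q + 3) * 9 / 18
    ≡⟨ /-congˡ {o = 18} (cong (_* 9) (≡.sym (τ*2≡q*[q+3] (suc q)))) ⟩
  τ (suc q) * 2 * 9 / 18
    ≡⟨ /-congˡ {o = 18} (*-assoc (τ (suc q)) 2 9) ⟩
  τ (suc q) * 18 / 18
    ≡⟨ m*n/n≡m (τ (suc q)) 18 ⟩
  τ (suc q) ∎)
  where
  open ≡-Reasoning
  factor : ∀ q → (1 + q * 3 + 2) * (1 + q * 3 + 11) ≡ suc q * (suc q + 3) * 9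
  factor = solve-∀

formula-2mod3 : ∀ q → (2 + q * 3 + 2) / 3 + 1 ≡ suc (suc q)
formula-2mod3 q = begin
  (2 + q * 3 + 2) / 3 + 1   ≡⟨ cong (_+ 1) (/-congˡ {o = 3} (regroup q)) ⟩
  (1 + suc q * 3) / 3 + 1   ≡⟨ cong (_+ 1) ([1+p*3]/3≡p (suc q)) ⟩
  suc q + 1                 ≡⟨ +-comm (suc q) 1 ⟩
  suc (suc q)               ∎
  where
  open ≡-Reasoning
  regroup : ∀ q → 2 + q * 3 + 2 ≡ 1 + suc q * 3
  regroup = solve-∀

theorem2p5 : (n : ℕ) → 2 ≤ n →
    (n % 3 ≡ 0 → ζ (P n) ≡ 1) ×
    (n % 3 ≡ 1 → ζ (P n) ≡ ((n + 2) * (n + 11)) / 18 ∸ 1) ×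
    (n % 3 ≡ 2 → ζ (P n) ≡ (n + 2) / 3 + 1)
theorem2p5 n _ = residue₀ , residue₁ , residue₂
  where
  q = n / 3

  r+q*3≡n : ∀ {r} → n % 3 ≡ r → r + q * 3 ≡ n
  r+q*3≡n refl = ≡.sym (m≡m%n+[m/n]*n n 3)

  residue₀ : n % 3 ≡ 0 → ζ (P n) ≡ 1
  residue₀ r = subst (λ m → ζ (P m) ≡ 1) (r+q*3≡n r)
    (ζ-P-lowestTerm (lowestTerms-3q q covered) (m≤m*n q 3))

  residue₁ : n % 3 ≡ 1 → ζ (P n) ≡ ((n + 2) * (n + 11)) / 18 ∸ 1
  residue₁ r = subst (λ m → ζ (P m) ≡ ((m + 2) * (m + 11)) / 18 ∸ 1) (r+q*3≡n r)
    (trans (ζ-P-lowestTerm (lowestTerms-3q+1 q covered) (s≤s (m≤m*n q 3)))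
           (≡.sym (formula-1mod3 q)))

  residue₂ : n % 3 ≡ 2 → ζ (P n) ≡ (n + 2) / 3 + 1
  residue₂ r = subst (λ m → ζ (P m) ≡ (m + 2) / 3 + 1) (r+q*3≡n r)
    (trans (ζ-P-lowestTerm (lowestTerms-3q+2 q covered) (s≤s (m≤n⇒m≤1+n (m≤m*n q 3))))
           (≡.sym (formula-2mod3 q)))
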